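{- For every relational structure $\mathbb{A}$, every path instance $I$ of $\mathrm{CSP}(\mathbb{A})$, and every $i\le j$ (variables of $I$), we have $\mathcal{S}^3_{\mathbb{A}}(I)\vdash\lambda_{I,i,j}(i,j)$.
   Context: A relational structure $\mathbb{A}=(A,\mathcal{R})$ is a finite set $A$ with finitely many basic relations of positive finite arity. A path instance of $\mathrm{CSP}(\mathbb{A})$ of length $\ell$ has variables $[\ell]$, exactly one unary constraint on each $i$ with basic relation $B_i\subseteq A$, exactly one binary constraint on each $(i,i+1)$, $i<\ell$, with basic relation $B_{i,i+1}$, and no other constraints. The graph $\mathrm{Conn}(I_{[i,j]})$ has vertex set the disjoint union of $B_i,\dots,B_j$ and, for each $k\in[i,j)$, an edge between $x\in B_k$ and $y\in B_{k+1}$ whenever $(x,y)\in B_{k,k+1}$; $\lambda_{I,i,j}$ is the set of pairs $(a,b)$, $a\in B_i$, $b\in B_j$, joined by a path (ignoring orientation) in this graph. The $r$-ary maximal symmetric Datalog program $\mathcal{S}^r_{\mathbb{A}}$: IDB predicates are all relations on $A$ of arity at most $r$, plus a non-IDB symbol for each basic relation of $\mathbb{A}$ of arity at most $r$. Rules $R(\rho)\leftarrow S_1(\sigma_1),\dots,S_\ell(\sigma_\ell)$ are all rules that (1) have an IDB on the left and at most one IDB on the right, (2) use only variables from $\{x_1,\dots,x_r\}$, (3) have no repeated atom on the right, (4) are consistent with $\mathbb{A}$: for every $f\colon\{x_1,\dots,x_r\}\to A$, if $f(\sigma_i)\in S_i$ for all $i$ then $f(\rho)\in R$, and (5) if the right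 side contains an IDB atom, the rule with the left atom and that right IDB atom exchanged is also consistent. Derivation on an instance $I=(V,\mathcal C)$: $\mathcal{S}^r_{\mathbb{A}}(I)\vdash R(\rho)$ if $(\rho,R)\in\mathcal C$, or there is a rule $R(\tau)\leftarrow S_1(\sigma_1),\dots,S_\ell(\sigma_\ell)$ and a map $\omega$ from program variables to $V$ with $\omega(\tau)=\rho$ and $\mathcal{S}^r_{\mathbb{A}}(I)\vdash S_i(\omega(\sigma_i))$ for all $i$. -}

module Defs where

open import Data.Nat using (ℕ; zero; suc; _≤_)
open import Data.Fin using (Fin; inject₁) renaming (_≤_ to _≤ᶠ_; suc to fsuc)
open import Data.Vec using (Vec; []; _∷_; map; toList)
open import Data.List using (List; []; _∷_) renaming (map to mapL)
open import Data.List.Relation.Unary.All using (All)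
open import Data.List.Relation.Unary.Unique.Propositional using (Unique)
open import Data.Maybe using (Maybe; just; nothing)
open import Data.Product using (Σ; Σ-syntax; _×_; _,_)
open import Data.Sum using (_⊎_)
open import Relation.Binary.PropositionalEquality using (_≡_)
open import Relation.Binary.Construct.Closure.Equivalence using (EqClosure)

record Structure : Set₁ where
  field
    size      : ℕ
    nrels     : ℕ
    arity     : Fin nrels → ℕ
    arity-pos : ∀ s → 1 ≤ arity s
    rel       : (s : Fin nrels) → Vec (Fin size) (arity s) → Set

module _ (𝔸 : Structure) where
  open Structure 𝔸

  Carrier : Set
  Carrier = Fin size

  Holds : Fin nrels → List Carrier → Set
  Holds s xs = Σ[ v ∈ Vec Carrier (arity s) ] (toList v ≡ xs × rel s v)

  -- Path instances of length ℓ = suc len (variables Fin ℓ, 0-indexed).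
  record PathInstance : Set where
    field
      len       : ℕ
      unary     : Fin (suc len) → Fin nrels
      unary-ar  : ∀ i → arity (unary i) ≡ 1
      binary    : Fin len → Fin nrels
      binary-ar : ∀ k → arity (binary k) ≡ 2

    Var : Set
    Var = Fin (suc len)

    Constraint : (s : Fin nrels) → Vec Var (arity s) → Set
    Constraint s ρ =
        (Σ[ i ∈ Var ] (s ≡ unary i × toList ρ ≡ i ∷ []))
      ⊎ (Σ[ k ∈ Fin len ] (s ≡ binary k × toList ρ ≡ inject₁ k ∷ fsuc k ∷ []))

    ConnEdge : Var → Var → (Var × Carrier) → (Var × Carrier) → Set
    ConnEdge i j (p , x) (q , y) =
      Σ[ k ∈ Fin len ]
        ( p ≡ inject₁ k × q ≡ fsuc k
        × i ≤ᶠ inject₁ k × fsuc k ≤ᶠ j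
        × Holds (unary p) (x ∷ []) × Holds (unary q) (y ∷ [])
        × Holds (binary k) (x ∷ y ∷ []) )

    lam : Var → Var → Vec Carrier 2 → Set
    lam i j (a ∷ b ∷ []) =
      Holds (unary i) (a ∷ []) × Holds (unary j) (b ∷ [])
      × EqClosure (ConnEdge i j) (i , a) (j , b)

  module Datalog (r : ℕ) where

    record IAtom : Set₁ where
      constructor iatom
      field
        k    : ℕ
        k≤r  : k ≤ r
        R    : Vec Carrier k → Set
        args : Vec (Fin r) k

    record EAtom : Set where
      constructor eatom
      field
        sym   : Fin nrels
        ar≤r  : arity sym ≤ r
        args  : Vec (Fin r) (arity sym)

    EKey : Set
    EKey = Σ[ s ∈ Fin nrels ] Vec (Fin r) (arity s)

    ekey : EAtom → EKey
    ekey (eatom s _ σ) = s , σ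

    IHolds : (Fin r → Carrier) → IAtom → Set
    IHolds f (iatom _ _ R σ) = R (map f σ)

    EHolds : (Fin r → Carrier) → EAtom → Set
    EHolds f (eatom s _ σ) = rel s (map f σ)

    MHolds : (Fin r → Carrier) → Maybe IAtom → Set
    MHolds f nothing  = Data.Unit.⊤ where import Data.Unit
    MHolds f (just a) = IHolds f a

    Consistent : IAtom → Maybe IAtom → List EAtom → Set
    Consistent hd mi es =
      (f : Fin r → Carrier) → MHolds f mi → All (EHolds f) es → IHolds f hd

    record Rule : Set₁ where
      field
        head       : IAtom
        idb        : Maybe IAtom
        edbs       : List EAtom
        norepeat   : Unique (mapL ekey edbs)
        consistent : Consistent head idb edbs
        symmetric  : (a : IAtom) → idb ≡ just a → Consistent a (just head) edbs

    module _ {V : Set} (C : (s : Fin nrels) → Vec V (arity s) → Set) where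

      data Derives : (k : ℕ) → (Vec Carrier k → Set) → Vec V k → Set₁ where
        byRule : (ρr : Rule) (ω : Fin r → V) {ρ : Vec V (IAtom.k (Rule.head ρr))} →
                 map ω (IAtom.args (Rule.head ρr)) ≡ ρ →
                 All (λ e → C (EAtom.sym e) (map ω (EAtom.args e))) (Rule.edbs ρr) →
                 ((a : IAtom) → Rule.idb ρr ≡ just a →
                    Derives (IAtom.k a) (IAtom.R a) (map ω (IAtom.args a))) →
                 Derives (IAtom.k (Rule.head ρr)) (IAtom.R (Rule.head ρr)) ρ

-- Fix i and the right end m of the window [i, m].  For i ≤ t ≤ m let
-- Reach i m t ⊆ B_i × B_t be the pairs joined by a path in Conn(I_[i,m]).
-- We derive Reach i m t (i, t) by induction on t, starting from t = i:
--   • start:   Reach i m i (x₀, x₀)      ← B_i(x₀)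
--   • advance: ReachStep i m k (x₀, x₁, x₂)
--                ← Reach i m k (x₀, x₁), B_{k,k+1}(x₁, x₂), B_{k+1}(x₂)
--   • forget:  Reach i m (k+1) (x₀, x₂)
--                ← ReachStep i m k (x₀, x₁, x₂), B_{k,k+1}(x₁, x₂), B_k(x₁)
-- where ReachStep remembers both the old and the new endpoint; the extra
-- atoms in "forget" are exactly what makes its reversal (condition (5))
-- consistent.  Finally λ_{I,i,m} = Reach i m m, which a rule without EDB
-- atoms transfers.
module Submission where

open import Defs
open import Data.Nat as ℕ using (ℕ; z≤n; s≤s)
open import Data.Nat.Properties using (≤-reflexive) renaming (≤-trans to ≤ℕ-trans; ≤-refl to ≤ℕ-refl)
open import Data.Fin using (Fin; zero; suc; toℕ; inject₁; _≤_; _≟_)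
open import Data.Fin.Properties
  using (≤-refl; ≤-trans; ≤∧≢⇒<; toℕ-inject₁; i≤inject₁[j]⇒i≤1+j)
open import Data.Fin.Induction using (<-weakInduction-startingFrom)
open import Data.Vec using (Vec; []; _∷_; lookup; toList; map; cast)
open import Data.Vec.Properties using (map-cast; toList-cast)
open import Data.List using ([]; _∷_)
open import Data.List.Relation.Unary.All using ([]; _∷_)
open import Data.List.Relation.Unary.AllPairs using ([]; _∷_)
open import Data.Maybe using (just; nothing)
open import Data.Product using (_×_; _,_; proj₁)
open import Data.Sum using (inj₁; inj₂)
open import Relation.Nullary using (yes; no)
open import Relation.Unary using (Pred)
open import Relation.Binary.PropositionalEquality
open import Relation.Binary.Construct.Closure.Equivalence
  using (EqClosure; symmetric; transitive; return)
open import Relation.Binary.Construct.Closure.ReflexiveTransitive using (ε)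

interval-induction : ∀ {n ℓ} (P : Pred (Fin (ℕ.suc n)) ℓ) {i : Fin (ℕ.suc n)} →
  P i → (∀ k → i ≤ inject₁ k → P (inject₁ k) → P (suc k)) →
  ∀ {j} → i ≤ j → P j
interval-induction P {i} Pi step i≤j =
  <-weakInduction-startingFrom (λ j → i ≤ j → P j) (λ _ → Pi) extend i≤j i≤j
  where
  extend : ∀ k → (i ≤ inject₁ k → P (inject₁ k)) → i ≤ suc k → P (suc k)
  extend k Pk i≤k+1 with i ≟ suc k
  ... | yes refl = Pi
  ... | no i≢k+1 = step k i≤k (Pk i≤k)
    where
    i≤k : i ≤ inject₁ k
    i≤k = subst (toℕ i ℕ.≤_) (sym (toℕ-inject₁ k)) (ℕ.s≤s⁻¹ (≤∧≢⇒< i≤k+1 i≢k+1))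

toList-map-cast : ∀ {X Y : Set} {m n} (f : X → Y) .(e : m ≡ n) (xs : Vec X m) →
  toList (map f (cast e xs)) ≡ toList (map f xs)
toList-map-cast f e xs = begin
  toList (map f (cast e xs))  ≡⟨ cong toList (map-cast f e xs) ⟩
  toList (cast e (map f xs))  ≡⟨ toList-cast e (map f xs) ⟩
  toList (map f xs)           ∎
  where open ≡-Reasoning

module EdbAtoms (𝔸 : Structure) where
  open Structure 𝔸
  open Datalog 𝔸 3

  atom : (s : Fin nrels) {n : ℕ} → arity s ≡ n → n ℕ.≤ 3 → Vec (Fin 3) n → EAtom
  atom s e n≤3 xs = eatom s (≤ℕ-trans (≤-reflexive e) n≤3) (cast (sym e) xs)

  atom-holds : ∀ s {n} (e : arity s ≡ n) n≤3 xs (f : Fin 3 → Carrier 𝔸) →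
    EHolds f (atom s e n≤3 xs) → Holds 𝔸 s (toList (map f xs))
  atom-holds s e _ xs f r = map f (cast (sym e) xs) , toList-map-cast f (sym e) xs , r

  keys-differ : ∀ {s s'} (σ : Vec (Fin 3) (arity s)) (σ' : Vec (Fin 3) (arity s')) →
    arity s ≢ arity s' → (s , σ) ≢ (s' , σ')
  keys-differ _ _ ar≢ar' same = ar≢ar' (cong (λ key → arity (proj₁ key)) same)

module PathDerivations (𝔸 : Structure) (I : PathInstance 𝔸) where
  open Structure 𝔸
  open PathInstance I
  open Datalog 𝔸 3
  open EdbAtoms 𝔸

  A : Set
  A = Carrier 𝔸

  D : ∀ k → (Vec A k → Set) → Vec Var k → Set₁
  D = Derives Constraint

  x₀ x₁ x₂ : Fin 3
  x₀ = zero
  x₁ = suc zero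
  x₂ = suc (suc zero)

  unaryAtom : Var → Fin 3 → EAtom
  unaryAtom t x = atom (unary t) (unary-ar t) (s≤s z≤n) (x ∷ [])

  binaryAtom : Fin len → Fin 3 → Fin 3 → EAtom
  binaryAtom k x y = atom (binary k) (binary-ar k) (s≤s (s≤s z≤n)) (x ∷ y ∷ [])

  binary≢unary : ∀ k t x y z → ekey (binaryAtom k x y) ≢ ekey (unaryAtom t z)
  binary≢unary k t x y z = keys-differ _ _ λ ar≡ar →
    2≢1 (trans (sym (binary-ar k)) (trans ar≡ar (unary-ar t)))
    where
    2≢1 : 2 ≢ 1
    2≢1 ()

  unaryAtom-holds : ∀ t x f → EHolds f (unaryAtom t x) → Holds 𝔸 (unary t) (f x ∷ [])
  unaryAtom-holds t x = atom-holds (unary t) (unary-ar t) (s≤s z≤n) (x ∷ [])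

  binaryAtom-holds : ∀ k x y f →
    EHolds f (binaryAtom k x y) → Holds 𝔸 (binary k) (f x ∷ f y ∷ [])
  binaryAtom-holds k x y = atom-holds (binary k) (binary-ar k) (s≤s (s≤s z≤n)) (x ∷ y ∷ [])

  unaryAtom-in-I : ∀ t x (ω : Fin 3 → Var) → ω x ≡ t →
    Constraint (unary t) (map ω (cast (sym (unary-ar t)) (x ∷ [])))
  unaryAtom-in-I t x ω refl = inj₁ (t , refl , toList-map-cast ω (sym (unary-ar t)) (x ∷ []))

  binaryAtom-in-I : ∀ k x y (ω : Fin 3 → Var) → ω x ≡ inject₁ k → ω y ≡ suc k →
    Constraint (binary k) (map ω (cast (sym (binary-ar k)) (x ∷ y ∷ [])))
  binaryAtom-in-I k x y ω ωx ωy =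
    inj₂ (k , refl , trans (toList-map-cast ω (sym (binary-ar k)) (x ∷ y ∷ []))
                           (cong₂ (λ u v → u ∷ v ∷ []) ωx ωy))

  Connected : Var → Var → (Var × A) → (Var × A) → Set
  Connected i m = EqClosure (ConnEdge i m)

  edge : ∀ {i m} k {a b} → i ≤ inject₁ k → suc k ≤ m →
    Holds 𝔸 (unary (inject₁ k)) (a ∷ []) → Holds 𝔸 (unary (suc k)) (b ∷ []) →
    Holds 𝔸 (binary k) (a ∷ b ∷ []) → Connected i m (inject₁ k , a) (suc k , b)
  edge k p q ua ub bab = return (k , refl , refl , p , q , ua , ub , bab)

  Reach : Var → Var → Var → Vec A 2 → Set
  Reach i m t (a ∷ b ∷ []) =
    Holds 𝔸 (unary i) (a ∷ []) × Holds 𝔸 (unary t) (b ∷ []) × Connected i m (i , a) (t , b)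

  ReachStep : Var → Var → Fin len → Vec A 3 → Set
  ReachStep i m k (a ∷ b ∷ c ∷ []) =
    Holds 𝔸 (unary i) (a ∷ []) × Holds 𝔸 (unary (inject₁ k)) (b ∷ [])
    × Holds 𝔸 (unary (suc k)) (c ∷ [])
    × Connected i m (i , a) (inject₁ k , b) × Connected i m (i , a) (suc k , c)

  startRule : Var → Var → Rule
  startRule i m = record
    { head       = iatom 2 (s≤s (s≤s z≤n)) (Reach i m i) (x₀ ∷ x₀ ∷ [])
    ; idb        = nothing
    ; edbs       = unaryAtom i x₀ ∷ []
    ; norepeat   = [] ∷ []
    ; consistent = λ { f _ (r ∷ []) →
        let ua = unaryAtom-holds i x₀ f r in ua , ua , ε }
    ; symmetric  = λ _ () }

  advanceRule : ∀ i m k → i ≤ inject₁ k → suc k ≤ m → Rule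
  advanceRule i m k p q = record
    { head       = iatom 3 ≤ℕ-refl (ReachStep i m k) (x₀ ∷ x₁ ∷ x₂ ∷ [])
    ; idb        = just (iatom 2 (s≤s (s≤s z≤n)) (Reach i m (inject₁ k)) (x₀ ∷ x₁ ∷ []))
    ; edbs       = binaryAtom k x₁ x₂ ∷ unaryAtom (suc k) x₂ ∷ []
    ; norepeat   = (binary≢unary k (suc k) x₁ x₂ x₂ ∷ []) ∷ [] ∷ []
    ; consistent = λ { f (ua , ub , a~b) (rb ∷ ru ∷ []) →
        let uc = unaryAtom-holds (suc k) x₂ f ru
            bc = binaryAtom-holds k x₁ x₂ f rb
        in ua , ub , uc , a~b , transitive _ a~b (edge k p q ub uc bc) }
    ; symmetric  = λ { _ refl f (ua , ub , _ , a~b , _) _ → ua , ub , a~b } }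

  -- Reach i m (k+1) (x₀, x₂) ← ReachStep i m k (x₀, x₁, x₂), B_{k,k+1}(x₁, x₂), B_k(x₁).
  -- The reversed rule recovers the forgotten middle point x₁ from the EDB atoms.
  forgetRule : ∀ i m k → i ≤ inject₁ k → suc k ≤ m → Rule
  forgetRule i m k p q = record
    { head       = iatom 2 (s≤s (s≤s z≤n)) (Reach i m (suc k)) (x₀ ∷ x₂ ∷ [])
    ; idb        = just (iatom 3 ≤ℕ-refl (ReachStep i m k) (x₀ ∷ x₁ ∷ x₂ ∷ []))
    ; edbs       = binaryAtom k x₁ x₂ ∷ unaryAtom (inject₁ k) x₁ ∷ []
    ; norepeat   = (binary≢unary k (inject₁ k) x₁ x₂ x₁ ∷ []) ∷ [] ∷ []
    ; consistent = λ { f (ua , _ , uc , _ , a~c) _ → ua , uc , a~c }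
    ; symmetric  = λ { _ refl f (ua , uc , a~c) (rb ∷ ru ∷ []) →
        let ub = unaryAtom-holds (inject₁ k) x₁ f ru
            bc = binaryAtom-holds k x₁ x₂ f rb
        in ua , ub , uc , transitive _ a~c (symmetric _ (edge k p q ub uc bc)) , a~c } }

  finishRule : Var → Var → Rule
  finishRule i m = record
    { head       = iatom 2 (s≤s (s≤s z≤n)) (lam i m) (x₀ ∷ x₁ ∷ [])
    ; idb        = just (iatom 2 (s≤s (s≤s z≤n)) (Reach i m m) (x₀ ∷ x₁ ∷ []))
    ; edbs       = []
    ; norepeat   = []
    ; consistent = λ { f r [] → r }
    ; symmetric  = λ { _ refl f r [] → r } }

  reach-start : ∀ i m → D 2 (Reach i m i) (i ∷ i ∷ [])
  reach-start i m =
    byRule (startRule i m) (λ _ → i) refl (unaryAtom-in-I i x₀ (λ _ → i) refl ∷ []) (λ _ ())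

  reach-step : ∀ i m k → i ≤ inject₁ k → suc k ≤ m →
    D 2 (Reach i m (inject₁ k)) (i ∷ inject₁ k ∷ []) → D 2 (Reach i m (suc k)) (i ∷ suc k ∷ [])
  reach-step i m k p q reach-k =
    byRule (forgetRule i m k p q) ω refl
      (binaryAtom-in-I k x₁ x₂ ω refl refl ∷ unaryAtom-in-I (inject₁ k) x₁ ω refl ∷ [])
      (λ { _ refl → step-k })
    where
    ω : Fin 3 → Var
    ω = lookup (i ∷ inject₁ k ∷ suc k ∷ [])

    step-k : D 3 (ReachStep i m k) (i ∷ inject₁ k ∷ suc k ∷ [])
    step-k = byRule (advanceRule i m k p q) ω refl
      (binaryAtom-in-I k x₁ x₂ ω refl refl ∷ unaryAtom-in-I (suc k) x₂ ω refl ∷ [])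
      (λ { _ refl → reach-k })

  reach : ∀ i m t → i ≤ t → t ≤ m → D 2 (Reach i m t) (i ∷ t ∷ [])
  reach i m t i≤t = interval-induction (λ t → t ≤ m → D 2 (Reach i m t) (i ∷ t ∷ []))
    (λ _ → reach-start i m)
    (λ k i≤k reach-k k+1≤m →
       reach-step i m k i≤k k+1≤m (reach-k (≤-trans (i≤inject₁[j]⇒i≤1+j ≤-refl) k+1≤m)))
    i≤t

  lam-derivable : ∀ i j → i ≤ j → D 2 (lam i j) (i ∷ j ∷ [])
  lam-derivable i j i≤j = byRule (finishRule i j) (lookup (i ∷ j ∷ j ∷ [])) refl []
    (λ { _ refl → reach i j j i≤j ≤-refl })

lemma18 : (𝔸 : Structure) (I : PathInstance 𝔸) →
    (i j : PathInstance.Var I) → i ≤ j →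
    Datalog.Derives 𝔸 3 (PathInstance.Constraint I) 2 (PathInstance.lam I i j) (i ∷ j ∷ [])
lemma18 𝔸 I = PathDerivations.lam-derivable 𝔸 I
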